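{- Let $\mathcal{V}$ be a unital commutative quantale, let $F\colon\mathsf{Set}\to\mathsf{Set}$ be a functor, let $\widehat{F}$ be a lifting of $F$ to $\mathcal{V}\text{ - }\mathsf{Pred}$, and let $\overline{F}$ be the corresponding Wasserstein lifting of $F$ to $\mathcal{V}\text{ - }\mathsf{Rel}$, i.e. for a $\mathcal{V}$-valued relation $p\colon X\times X\to\mathcal{V}$ and $t_1,t_2\in FX$, \[ \overline{F}(p)(t_1,t_2)=\bigvee\{\widehat{F}(p)(t)\mid t\in F(X\times X),\ F\pi_i(t)=t_i\ (i=1,2)\}, \] where $p$ is regarded as a $\mathcal{V}$-valued predicate on $X\times X$. Then: \begin{itemize} \item If $\widehat{F}(1_X)\ge 1_{FX}$, then $\overline{F}(\Delta_X)\ge\Delta_{FX}$; hence $\overline{F}$ preserves reflexive relations. \item If $\widehat{F}$ is a fibred lifting, $F$ preserves weak pullbacks, and $\widehat{F}(p\otimes q)\ge\widehat{F}(p)\otimes\widehat{F}(q)$ for all $\mathcal{V}$-valued predicates $p,q$ on the same set, then $\overline{F}(p\cdot q)\ge\overline{F}(p)\cdot\overline{F}(q)$ for all $\mathcal{V}$-valued relations $p,q$ on the same set; hence $\overline{F}$ preserves transitive relations. \item $\overline{F}$ preserves symmetric relations. \end{itemize} Consequently, when $\widehat{F}(1_X)\ge 1_{FX}$, $\widehat{F}$ is a fibred lifting, $F$ preserves weak pullbacks and $\widehat{F}(p\otimes q)\ge\widehat{F}(p)\otimes\widehat{F}(q)$, the Wasserstein lifting $\overline{F}$ restricts to a lifting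 of $F$ to both $\mathcal{V}\text{ - }\mathsf{Cat}$ and $\mathcal{V}\text{ - }\mathsf{Cat}_{\mathsf{sym}}$.
   Context: $\mathcal{V}$ is a unital commutative quantale with unit $1$ and tensor $\otimes$. $\mathcal{V}\text{ - }\mathsf{Pred}$ is the category whose objects are maps $p\colon X\to\mathcal{V}$ and whose morphisms $p\to q$ (with $q\colon Y\to\mathcal{V}$) are maps $f\colon X\to Y$ with $p\le q\circ f$ pointwise; $\mathcal{V}\text{ - }\mathsf{Rel}$ is defined likewise with objects $r\colon X\times X\to\mathcal{V}$ and condition $r\le q\circ(f\times f)$. Both are fibrations over $\mathsf{Set}$ (forgetful functor), with reindexing given by precomposition. A lifting $\widehat{F}$ of $F$ satisfies $p'\widehat{F}=Fp$ for the forgetful functors; it is fibred if the canonical morphism $\widehat{F}(f^*R)\to (Ff)^*(\widehat{F}R)$ is an isomorphism. $1_X\colon X\to\mathcal{V}$ is the constant predicate $x\mapsto 1$; $(u\otimes v)(x)=u(x)\otimes v(x)$. The diagonal relation $\Delta_X$ has $\Delta_X(x,y)=1$ if $x=y$ and $\bot$ otherwise. The composition of relations is $(p\cdot q)(x,y)=\bigvee_{z}p(x,z)\otimes q(z,y)$. A relation $r$ is reflexive if $r\ge\Delta_X$, transitive if $r\cdot r\le r$, symmetric if $r=r\circ\mathrm{sym}_X$ where $\mathrm{sym}_X$ swaps components. $\mathcal{V}\text{ - }\mathsf{Cat}$ is the full subcategory of $\mathcal{V}\text{ - }\mathsf{Rel}$ of reflexive transitive relations, and $\mathcal{V}\text{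 - }\mathsf{Cat}_{\mathsf{sym}}$ those that are additionally symmetric. -}

module Defs where

open import Level using (Level; _⊔_) renaming (suc to lsuc; zero to lzero)
open import Data.Product using (Σ; _×_; _,_; proj₁; proj₂; swap)
open import Function using (_∘_; id)
open import Relation.Binary.PropositionalEquality using (_≡_)

-- A complete lattice (joins of arbitrary Set-indexed families) with an
-- associative, commutative, unital tensor distributing over all joins
-- (on both sides; by commutativity one side suffices).

record Quantale (c : Level) : Set (lsuc c ⊔ lsuc lzero) where
  infix  4 _≤_
  infixr 7 _⊗_
  field
    Carrier  : Set c
    _≤_      : Carrier → Carrier → Set c
    ≤-refl   : ∀ {a} → a ≤ a
    ≤-trans  : ∀ {a b d} → a ≤ b → b ≤ d → a ≤ d
    ≤-antisym : ∀ {a b} → a ≤ b → b ≤ a → a ≡ b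
    ⋁        : {I : Set} → (I → Carrier) → Carrier
    ⋁-upper  : {I : Set} (f : I → Carrier) (i : I) → f i ≤ ⋁ f
    ⋁-least  : {I : Set} (f : I → Carrier) (b : Carrier) →
               (∀ i → f i ≤ b) → ⋁ f ≤ b
    _⊗_      : Carrier → Carrier → Carrier
    𝟏        : Carrier
    ⊗-assoc  : ∀ a b d → (a ⊗ b) ⊗ d ≡ a ⊗ (b ⊗ d)
    ⊗-comm   : ∀ a b → a ⊗ b ≡ b ⊗ a
    ⊗-unitˡ  : ∀ a → 𝟏 ⊗ a ≡ a
    ⊗-distrib-⋁ : ∀ a {I : Set} (f : I → Carrier) → a ⊗ ⋁ f ≡ ⋁ (λ i → a ⊗ f i)

record Functor : Set₁ where
  field
    F₀      : Set → Set
    fmap    : {X Y : Set} → (X → Y) → F₀ X → F₀ Y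
    fmap-cong : {X Y : Set} {f g : X → Y} → (∀ x → f x ≡ g x) →
                ∀ t → fmap f t ≡ fmap g t
    fmap-id : {X : Set} → ∀ (t : F₀ X) → fmap id t ≡ t
    fmap-∘  : {X Y Z : Set} (g : Y → Z) (f : X → Y) →
              ∀ t → fmap (g ∘ f) t ≡ fmap g (fmap f t)

IsWeakPullback : {W X Y Z : Set} (f : X → Z) (g : Y → Z)
                 (p₁ : W → X) (p₂ : W → Y) → Set
IsWeakPullback {W} {X} {Y} f g p₁ p₂ =
  (∀ w → f (p₁ w) ≡ g (p₂ w)) ×
  (∀ x y → f x ≡ g y → Σ W λ w → (p₁ w ≡ x) × (p₂ w ≡ y))

PreservesWeakPullbacks : Functor → Set₁
PreservesWeakPullbacks F =
  ∀ {W X Y Z : Set} (f : X → Z) (g : Y → Z) (p₁ : W → X) (p₂ : W → Y) →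
  IsWeakPullback f g p₁ p₂ →
  IsWeakPullback (fmap f) (fmap g) (fmap p₁) (fmap p₂)
  where open Functor F

module _ {c : Level} (𝕍 : Quantale c) where
  open Quantale 𝕍

  Pred : Set → Set c
  Pred X = X → Carrier

  Rel : Set → Set c
  Rel X = X × X → Carrier

  -- Liftings of F to V-Pred: a predicate p on X is sent to a predicate on
  -- F X, and every V-Pred morphism f : p → q (p ≤ q ∘ f) is sent to F f,
  -- which must be a V-Pred morphism F̂ p → F̂ q.  (Functoriality is
  -- automatic since morphisms are determined by their underlying maps.)
  record PredLifting (F : Functor) : Set (lsuc lzero ⊔ c) where
    open Functor F
    field
      F̂      : {X : Set} → Pred X → Pred (F₀ X)
      F̂-mono : {X Y : Set} (p : Pred X) (q : Pred Y) (f : X → Y) →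
               (∀ x → p x ≤ q (f x)) →
               ∀ t → F̂ p t ≤ F̂ q (fmap f t)

  -- Fibred: the canonical morphism F̂ (f* q) → (F f)* (F̂ q) is an iso;
  -- in the (posetal) fibres, iso means equality.
  IsFibred : {F : Functor} → PredLifting F → Set (lsuc lzero ⊔ c)
  IsFibred {F} L = ∀ {X Y : Set} (f : X → Y) (q : Pred Y) (t : F₀ X) →
                   F̂ (q ∘ f) t ≡ F̂ q (fmap f t)
    where open Functor F
          open PredLifting L

  𝟏ₚ : (X : Set) → Pred X
  𝟏ₚ X _ = 𝟏

  _⊗ₚ_ : {X : Set} → Pred X → Pred X → Pred X
  (p ⊗ₚ q) x = p x ⊗ q x

  -- diagonal relation: Δ(x,y) = 1 if x = y and ⊥ otherwise, written as
  -- the join of 1 over proofs of x ≡ y (classically the same thing).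
  Δ : (X : Set) → Rel X
  Δ X (x , y) = ⋁ {x ≡ y} (λ _ → 𝟏)

  _·_ : {X : Set} → Rel X → Rel X → Rel X
  _·_ {X} p q (x , y) = ⋁ {X} (λ z → p (x , z) ⊗ q (z , y))

  _≤ᵣ_ : {X : Set} → Rel X → Rel X → Set c
  r ≤ᵣ s = ∀ xy → r xy ≤ s xy

  Reflexive : {X : Set} → Rel X → Set c
  Reflexive {X} r = Δ X ≤ᵣ r

  Transitive : {X : Set} → Rel X → Set c
  Transitive r = (r · r) ≤ᵣ r

  Symmetric : {X : Set} → Rel X → Set c
  Symmetric r = ∀ xy → r xy ≡ r (swap xy)

  module _ {F : Functor} (L : PredLifting F) where
    open Functor F
    open PredLifting L

    Wasserstein : {X : Set} → Rel X → Rel (F₀ X)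
    Wasserstein {X} p (t₁ , t₂) =
      ⋁ {Σ (F₀ (X × X)) λ t → (fmap proj₁ t ≡ t₁) × (fmap proj₂ t ≡ t₂)}
        (λ w → F̂ p (proj₁ w))

module Submission where

open import Defs
open import Level using (Level; _⊔_) renaming (suc to lsuc; zero to lzero)
open import Data.Product using (_×_; _,_; proj₁; proj₂; swap)
open import Data.Product.Base using (map)
open import Function using (_∘_; id)
open import Relation.Binary.Bundles using (Preorder)
open import Relation.Binary.PropositionalEquality using (_≡_; refl; sym; trans; cong; cong₂; isEquivalence)
import Relation.Binary.Reasoning.Preorder as PreorderReasoning

-- Each property of F̄ r is obtained by exhibiting a coupling: an element w of F W together
-- with a map h : W → X × X whose marginals are the prescribed ones; F̂ sends w to a lower
-- bound of F̄. For reflexivity, symmetry and transitivity, h is the diagonal, the swap and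
-- the outer projection X × X × X → X × X; in the last case w glues two couplings along a
-- weak pullback, which needs F̂ fibred and lax monoidal.

module _ {c : Level} (𝕍 : Quantale c) where
  open Quantale 𝕍

  ≡⇒≤ : ∀ {a b} → a ≡ b → a ≤ b
  ≡⇒≤ refl = ≤-refl

  ≤-preorder : Preorder c c c
  ≤-preorder = record
    { _≈_ = _≡_ ; _≲_ = _≤_
    ; isPreorder = record { isEquivalence = isEquivalence ; reflexive = ≡⇒≤ ; trans = ≤-trans } }

  module ≤-Reasoning = PreorderReasoning ≤-preorder

  ⋁-⊗-⋁-least : {I J : Set} (f : I → Carrier) (g : J → Carrier) (b : Carrier) →
                (∀ i j → f i ⊗ g j ≤ b) → ⋁ f ⊗ ⋁ g ≤ b
  ⋁-⊗-⋁-least f g b fg≤b = begin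
    ⋁ f ⊗ ⋁ g             ≡⟨ ⊗-comm (⋁ f) (⋁ g) ⟩
    ⋁ g ⊗ ⋁ f             ≡⟨ ⊗-distrib-⋁ (⋁ g) f ⟩
    ⋁ (λ i → ⋁ g ⊗ f i)   ≲⟨ ⋁-least _ b ⋁g⊗f≤b ⟩
    b                     ∎
    where
    open ≤-Reasoning
    ⋁g⊗f≤b : ∀ i → ⋁ g ⊗ f i ≤ b
    ⋁g⊗f≤b i = begin
      ⋁ g ⊗ f i             ≡⟨ ⊗-comm (⋁ g) (f i) ⟩
      f i ⊗ ⋁ g             ≡⟨ ⊗-distrib-⋁ (f i) g ⟩
      ⋁ (λ j → f i ⊗ g j)   ≲⟨ ⋁-least _ b (fg≤b i) ⟩
      b                     ∎

module _ {X : Set} where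
  outer : X × (X × X) → X × X
  outer (x , _ , z) = x , z

  left : X × (X × X) → X × X
  left (x , y , _) = x , y

  composable-weakPullback : IsWeakPullback {X × (X × X)} proj₂ proj₁ left proj₂
  composable-weakPullback =
    (λ _ → refl) , λ { (x , y) (_ , z) y≡y′ → (x , y , z) , refl , cong (_, z) y≡y′ }

module WassersteinProperties {c : Level} (𝕍 : Quantale c) {F : Functor} (L : PredLifting 𝕍 F) where
  open Quantale 𝕍
  open Functor F
  open PredLifting L

  F̄ : {X : Set} → Rel 𝕍 X → Rel 𝕍 (F₀ X)
  F̄ = Wasserstein 𝕍 L

  UnitLax : Set (lsuc lzero ⊔ c)
  UnitLax = ∀ (X : Set) (t : F₀ X) → 𝟏 ≤ F̂ (𝟏ₚ 𝕍 X) t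

  TensorLax : Set (lsuc lzero ⊔ c)
  TensorLax = ∀ (X : Set) (p q : Pred 𝕍 X) (t : F₀ X) → F̂ p t ⊗ F̂ q t ≤ F̂ (_⊗ₚ_ 𝕍 p q) t

  F̂-≤-F̄-along : {W X : Set} (h : W → X × X) {p : Pred 𝕍 W} {r : Rel 𝕍 X} →
                (∀ w → p w ≤ r (h w)) →
                ∀ {w t₁ t₂} → fmap (proj₁ ∘ h) w ≡ t₁ → fmap (proj₂ ∘ h) w ≡ t₂ →
                F̂ p w ≤ F̄ r (t₁ , t₂)
  F̂-≤-F̄-along h {p} {r} p≤r∘h {w} e₁ e₂ =
    ≤-trans (F̂-mono p r h p≤r∘h w)
      (⋁-upper _ (fmap h w , trans (sym (fmap-∘ proj₁ h w)) e₁
                           , trans (sym (fmap-∘ proj₂ h w)) e₂))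

  F̄-map : ∀ {X Y : Set} {r : Rel 𝕍 X} {s : Rel 𝕍 Y} (f : X → Y) →
          _≤ᵣ_ 𝕍 r (s ∘ map f f) → _≤ᵣ_ 𝕍 (F̄ r) (F̄ s ∘ map (fmap f) (fmap f))
  F̄-map f r≤s (t₁ , t₂) = ⋁-least _ _ λ { (t , e₁ , e₂) →
    F̂-≤-F̄-along (map f f) r≤s (trans (fmap-∘ f proj₁ t) (cong (fmap f) e₁))
                              (trans (fmap-∘ f proj₂ t) (cong (fmap f) e₂)) }

  F̄-mono : ∀ {X : Set} {r s : Rel 𝕍 X} → _≤ᵣ_ 𝕍 r s → _≤ᵣ_ 𝕍 (F̄ r) (F̄ s)
  F̄-mono r≤s (t₁ , t₂) = ⋁-least _ _ λ { (t , e₁ , e₂) → F̂-≤-F̄-along id r≤s e₁ e₂ }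

  Δ-≤-F̄Δ : UnitLax → ∀ (X : Set) → _≤ᵣ_ 𝕍 (Δ 𝕍 (F₀ X)) (F̄ (Δ 𝕍 X))
  Δ-≤-F̄Δ unit X (t , _) = ⋁-least _ _ λ { refl →
    ≤-trans (unit X t)
      (F̂-≤-F̄-along (λ x → x , x) (λ _ → ⋁-upper _ refl) (fmap-id t) (fmap-id t)) }

  F̄-reflexive : UnitLax → ∀ (X : Set) (r : Rel 𝕍 X) → Reflexive 𝕍 r → Reflexive 𝕍 (F̄ r)
  F̄-reflexive unit X r Δ≤r xy = ≤-trans (Δ-≤-F̄Δ unit X xy) (F̄-mono Δ≤r xy)

  F̄-swap-≤ : ∀ {X : Set} {r : Rel 𝕍 X} → Symmetric 𝕍 r → ∀ t₁ t₂ → F̄ r (t₁ , t₂) ≤ F̄ r (t₂ , t₁)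
  F̄-swap-≤ r-sym t₁ t₂ = ⋁-least _ _ λ { (t , e₁ , e₂) →
    F̂-≤-F̄-along swap (λ xy → ≡⇒≤ 𝕍 (r-sym xy)) e₂ e₁ }

  F̄-symmetric : ∀ (X : Set) (r : Rel 𝕍 X) → Symmetric 𝕍 r → Symmetric 𝕍 (F̄ r)
  F̄-symmetric X r r-sym (t₁ , t₂) = ≤-antisym (F̄-swap-≤ r-sym t₁ t₂) (F̄-swap-≤ r-sym t₂ t₁)

  module _ (fibred : IsFibred 𝕍 L) (wpb : PreservesWeakPullbacks F) (tensor : TensorLax) where

    glue-couplings : ∀ {X : Set} (p q : Rel 𝕍 X) {t₁ t₂ t₃ : F₀ X} (u v : F₀ (X × X)) →
                     fmap proj₁ u ≡ t₁ → fmap proj₂ u ≡ t₂ →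
                     fmap proj₁ v ≡ t₂ → fmap proj₂ v ≡ t₃ →
                     F̂ p u ⊗ F̂ q v ≤ F̄ (_·_ 𝕍 p q) (t₁ , t₃)
    glue-couplings {X} p q u v e₁ e₂ e₃ e₄
      with proj₂ (wpb proj₂ proj₁ left proj₂ composable-weakPullback) u v (trans e₂ (sym e₃))
    ... | w , left-w≡u , right-w≡v = begin
      F̂ p u ⊗ F̂ q v                     ≡⟨ cong₂ _⊗_ (reindex p left left-w≡u)
                                                     (reindex q proj₂ right-w≡v) ⟩
      F̂ (p ∘ left) w ⊗ F̂ (q ∘ proj₂) w ≲⟨ tensor (X × (X × X)) (p ∘ left) (q ∘ proj₂) w ⟩
      F̂ (_⊗ₚ_ 𝕍 (p ∘ left) (q ∘ proj₂)) w
        ≲⟨ F̂-≤-F̄-along outer (λ { (_ , y , _) → ⋁-upper _ y })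
             (trans (fmap-∘ proj₁ left w) (trans (cong (fmap proj₁) left-w≡u) e₁))
             (trans (fmap-∘ proj₂ proj₂ w) (trans (cong (fmap proj₂) right-w≡v) e₄)) ⟩
      F̄ (_·_ 𝕍 p q) (_ , _) ∎
      where
      reindex : ∀ {Y} (r : Rel 𝕍 X) (f : Y → X × X) {y t} → fmap f y ≡ t → F̂ r t ≡ F̂ (r ∘ f) y
      reindex r f {y} refl = sym (fibred f r y)
      open ≤-Reasoning 𝕍

    F̄·F̄-≤-F̄· : ∀ (X : Set) (p q : Rel 𝕍 X) → _≤ᵣ_ 𝕍 (_·_ 𝕍 (F̄ p) (F̄ q)) (F̄ (_·_ 𝕍 p q))
    F̄·F̄-≤-F̄· X p q (t₁ , t₃) = ⋁-least _ _ λ t₂ →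
      ⋁-⊗-⋁-least 𝕍 _ _ _ λ { (u , e₁ , e₂) (v , e₃ , e₄) → glue-couplings p q u v e₁ e₂ e₃ e₄ }

    F̄-transitive : ∀ (X : Set) (r : Rel 𝕍 X) → Transitive 𝕍 r → Transitive 𝕍 (F̄ r)
    F̄-transitive X r r·r≤r xy = ≤-trans (F̄·F̄-≤-F̄· X r r xy) (F̄-mono r·r≤r xy)

open WassersteinProperties

theorem21 : {c : Level} (𝕍 : Quantale c) (F : Functor) (L : PredLifting 𝕍 F) →
    let open Quantale 𝕍
        open Functor F
        open PredLifting L
        F̄ = Wasserstein 𝕍 L
    in
    -- (1) reflexivity
    ((∀ (X : Set) (t : F₀ X) → 𝟏 ≤ F̂ (𝟏ₚ 𝕍 X) t) →
      (∀ (X : Set) → _≤ᵣ_ 𝕍 (Δ 𝕍 (F₀ X)) (F̄ (Δ 𝕍 X)))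
      × (∀ (X : Set) (r : Rel 𝕍 X) → Reflexive 𝕍 r → Reflexive 𝕍 (F̄ r)))
    -- (2) transitivity
    × (IsFibred 𝕍 L → PreservesWeakPullbacks F →
       (∀ (X : Set) (p q : Pred 𝕍 X) (t : F₀ X) →
          F̂ p t ⊗ F̂ q t ≤ F̂ (_⊗ₚ_ 𝕍 p q) t) →
      (∀ (X : Set) (p q : Rel 𝕍 X) →
          _≤ᵣ_ 𝕍 (_·_ 𝕍 (F̄ p) (F̄ q)) (F̄ (_·_ 𝕍 p q)))
      × (∀ (X : Set) (r : Rel 𝕍 X) → Transitive 𝕍 r → Transitive 𝕍 (F̄ r)))
    -- (3) symmetry
    × (∀ (X : Set) (r : Rel 𝕍 X) → Symmetric 𝕍 r → Symmetric 𝕍 (F̄ r))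
    -- consequence: F̄ is a lifting of F to V-Rel restricting to V-Cat and V-Cat_sym
    × ((∀ (X : Set) (t : F₀ X) → 𝟏 ≤ F̂ (𝟏ₚ 𝕍 X) t) →
       IsFibred 𝕍 L → PreservesWeakPullbacks F →
       (∀ (X : Set) (p q : Pred 𝕍 X) (t : F₀ X) →
          F̂ p t ⊗ F̂ q t ≤ F̂ (_⊗ₚ_ 𝕍 p q) t) →
      (∀ (X Y : Set) (r : Rel 𝕍 X) (s : Rel 𝕍 Y) (f : X → Y) →
          _≤ᵣ_ 𝕍 r (s ∘ map f f) → _≤ᵣ_ 𝕍 (F̄ r) (F̄ s ∘ map (fmap f) (fmap f)))
      × (∀ (X : Set) (r : Rel 𝕍 X) → Reflexive 𝕍 r → Transitive 𝕍 r →
           Reflexive 𝕍 (F̄ r) × Transitive 𝕍 (F̄ r))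
      × (∀ (X : Set) (r : Rel 𝕍 X) → Reflexive 𝕍 r → Transitive 𝕍 r → Symmetric 𝕍 r →
           Reflexive 𝕍 (F̄ r) × Transitive 𝕍 (F̄ r) × Symmetric 𝕍 (F̄ r)))
theorem21 𝕍 F L =
  (λ unit → Δ-≤-F̄Δ 𝕍 L unit , F̄-reflexive 𝕍 L unit) ,
  (λ fibred wpb tensor → F̄·F̄-≤-F̄· 𝕍 L fibred wpb tensor , F̄-transitive 𝕍 L fibred wpb tensor) ,
  F̄-symmetric 𝕍 L ,
  λ unit fibred wpb tensor →
    let reflexive X r r-refl = F̄-reflexive 𝕍 L unit X r r-refl
        transitive X r r-trans = F̄-transitive 𝕍 L fibred wpb tensor X r r-trans
    in (λ X Y r s → F̄-map 𝕍 L) ,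
       (λ X r r-refl r-trans → reflexive X r r-refl , transitive X r r-trans) ,
       (λ X r r-refl r-trans r-sym →
          reflexive X r r-refl , transitive X r r-trans , F̄-symmetric 𝕍 L X r r-sym)
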